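{- Let $d\ge 1$, $\Omega=\mathbb F_2^d$, let $\tau$ be a nonidentity translation $x\mapsto x+c$ of $\Omega$, and let $X\subseteq\Omega$. Write $X(\tau-1)$ for the symmetric difference $X+X\tau$. Then: (i) if $|X|$ is even, $X(\tau-1)\in RM(d-2,d)$; (ii) if $|X|$ is odd, there is a $\tau$-invariant affine $1$-dimensional subspace $Q$ of $\Omega$ such that $X(\tau-1)\in Q+RM(d-2,d)$; (iii) in (ii), if $Q,Q'$ are affine $1$-dimensional subspaces with $X(\tau-1)\in Q+RM(d-2,d)=Q'+RM(d-2,d)$, then $Q'$ is a translate of $Q$ and both are $\tau$-invariant.
   Context: Subsets of $\Omega$ are identified with binary vectors indexed by $\Omega$, with addition the symmetric difference. For $0\le k\le d$, the Reed–Muller code $RM(k,d)$ is the span of the affine subspaces of $\Omega$ of codimension at most $k$; $RM(p,d)=0$ for $p<0$. $Q+RM(d-2,d)$ denotes the coset $\{Q+C: C\in RM(d-2,d)\}$. -}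

module Defs where

open import Data.Bool using (Bool; true; false; _xor_; if_then_else_)
open import Data.Bool.Properties using () renaming (_≟_ to _≟ᵇ_)
open import Data.Nat using (ℕ; zero; suc; _+_; _≤_)
open import Data.Integer using (ℤ; +_; -[1+_])
open import Data.List using (List; []; _∷_; map; _++_; foldr)
open import Data.Nat.ListAction using (sum)
open import Data.Bool.ListAction using (any)
open import Data.List.Relation.Unary.All using (All)
open import Data.Vec using (Vec; []; _∷_; zipWith; replicate)
open import Data.Vec.Properties using (≡-dec)
open import Data.Product using (Σ; _×_; ∃)
open import Relation.Nullary.Decidable using (⌊_⌋)
open import Relation.Binary.PropositionalEquality using (_≡_)

Ω : ℕ → Set
Ω d = Vec Bool d

infixl 6 _⊕_
_⊕_ : ∀ {d} → Ω d → Ω d → Ω d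
_⊕_ = zipWith _xor_

0Ω : ∀ {d} → Ω d
0Ω = replicate _ false

_≟Ω_ : ∀ {d} (x y : Ω d) → Relation.Nullary.Decidable.Dec (x ≡ y)
_≟Ω_ = ≡-dec _≟ᵇ_

allVecs : (n : ℕ) → List (Vec Bool n)
allVecs zero = [] ∷ []
allVecs (suc n) = map (false ∷_) (allVecs n) ++ map (true ∷_) (allVecs n)

-- subsets of Ω as binary vectors indexed by Ω (characteristic functions)
Sub : ℕ → Set
Sub d = Ω d → Bool

_⊕ₛ_ : ∀ {d} → Sub d → Sub d → Sub d
(S ⊕ₛ T) x = S x xor T x

card : ∀ {d} → Sub d → ℕ
card {d} X = sum (map (λ x → if X x then 1 else 0) (allVecs d))

lincomb : ∀ {m d} → Vec Bool m → Vec (Ω d) m → Ω d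
lincomb [] [] = 0Ω
lincomb (false ∷ ls) (v ∷ vs) = lincomb ls vs
lincomb (true ∷ ls) (v ∷ vs) = v ⊕ lincomb ls vs

LinIndep : ∀ {m d} → Vec (Ω d) m → Set
LinIndep {m} vs = (ls : Vec Bool m) → lincomb ls vs ≡ 0Ω → ls ≡ replicate m false

-- an affine subspace a + span(v₁,…,v_m) with v₁,…,v_m linearly independent;
-- its dimension is m and its codimension is d - m.
record AffSub (d : ℕ) : Set where
  field
    dim   : ℕ
    base  : Ω d
    dirs  : Vec (Ω d) dim
    indep : LinIndep dirs
open AffSub public

⟦_⟧ : ∀ {d} → AffSub d → Sub d
⟦ A ⟧ x = any (λ ls → ⌊ x ≟Ω (base A ⊕ lincomb ls (dirs A)) ⌋) (allVecs (dim A))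

-- S ∈ RM(k,d): S is a sum of affine subspaces of codimension ≤ k;
-- RM(k,d) = 0 for k < 0.
RM : ℤ → (d : ℕ) → Sub d → Set
RM -[1+ _ ] d S = ∀ x → S x ≡ false
RM (+ k) d S = Σ (List (AffSub d)) λ As →
  All (λ A → d ≤ dim A + k) As ×
  (∀ x → S x ≡ foldr (λ A b → ⟦ A ⟧ x xor b) false As)

InCoset : ∀ {d} → Sub d → ℤ → Sub d → Set
InCoset {d} Q k S = RM k d (S ⊕ₛ Q)

CosetEq : ∀ {d} → ℤ → Sub d → Sub d → Set
CosetEq {d} k Q Q' = ∀ (S : Sub d) → (InCoset Q k S → InCoset Q' k S) × (InCoset Q' k S → InCoset Q k S)

_τ[_] : ∀ {d} → Sub d → Ω d → Sub d
(X τ[ c ]) y = X (y ⊕ c)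

Xτ-1 : ∀ {d} → Ω d → Sub d → Sub d
Xτ-1 c X = X ⊕ₛ (X τ[ c ])

Invariant : ∀ {d} → Ω d → Sub d → Set
Invariant c S = ∀ x → S (x ⊕ c) ≡ S x

IsTranslate : ∀ {d} → Sub d → Sub d → Set
IsTranslate {d} S' S = ∃ λ (t : Ω d) → ∀ x → S' x ≡ S (x ⊕ t)

-- Over 𝔽₂, X(τ − 1) = Σ_{x ∈ X} {x, x + c}, and {x, x + c} = {0, c} + ⟨c, x⟩, where the
-- plane ⟨c, x⟩ (empty for x ∈ {0, c}) has codimension d − 2. Hence X(τ − 1) ≡ |X|·{0, c}
-- modulo RM(d − 2, d), which gives (i) and (ii).
-- For (iii), the linear map S ↦ Σ_{s ∈ S} s ∈ Ω vanishes on affine subspaces of dimension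
-- ≥ 2, hence on RM(d − 2, d); it sends a line to its direction and X(τ − 1) to |X|·c. So
-- for odd |X| every line in the coset of X(τ − 1) has direction c: it is τ-invariant, and
-- any two such lines are translates of each other.

{-# OPTIONS --safe #-}
module Submission where

open import Defs
open import Data.Nat using (ℕ; _≤_)
open import Data.Nat.Divisibility using (_∣_)
open import Data.Integer using (+_; _-_)
open import Data.Product using (Σ; _×_)
open import Relation.Nullary using (¬_)
open import Relation.Binary.PropositionalEquality using (_≡_; _≢_)

open import Algebra.Bundles using (CommutativeSemigroup)
import Algebra.Properties.CommutativeSemigroup as CommutativeSemigroupProperties
open import Data.Bool using (Bool; true; false; _∧_; _∨_; _xor_; not; if_then_else_; T)
open import Data.Bool.ListAction using (any; or)
open import Data.Bool.Properties
  using (xor-assoc; xor-comm; xor-identityˡ; xor-identityʳ; xor-same; not-involutive;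
         not-distribˡ-xor; ∧-distribʳ-xor; ∧-distribˡ-xor; ∧-zeroʳ; ∨-assoc; ∨-comm; ∨-identityʳ;
         xor-∧-commutativeRing)
open import Data.Empty using (⊥)
open import Data.Fin using (Fin)
open import Data.Integer using (-[1+_])
open import Data.List using (List; []; _∷_; map; _++_; foldr)
open import Data.List.Properties using (map-++; map-∘; map-cong)
open import Data.List.Relation.Unary.All using (All; []; _∷_)
import Data.List.Relation.Unary.All as All
open import Data.List.Relation.Unary.Any using (satisfied)
open import Data.List.Relation.Unary.Any.Properties using (any⁻)
open import Data.Maybe using (Maybe; just; nothing)
open import Data.Nat using (zero; suc; _+_; _*_; s≤s)
open import Data.Nat.Divisibility using (divides)
open import Data.Nat.ListAction using (sum)
open import Data.Nat.Properties using (+-cancelʳ-≤; ≤-reflexive)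
open import Data.Product using (_,_; proj₁)
open import Data.Vec using (Vec; []; _∷_; lookup; tabulate)
open import Data.Vec.Properties
  using (zipWith-assoc; zipWith-comm; zipWith-identityˡ; zipWith-identityʳ;
         ∷-injectiveˡ; ∷-injectiveʳ; lookup-zipWith; tabulate-cong; tabulate∘lookup)
open import Function using (_∘_)
open import Level using (0ℓ)
open import Relation.Binary.PropositionalEquality
  using (refl; sym; trans; cong; cong₂; module ≡-Reasoning)
open import Relation.Binary.PropositionalEquality.Algebra using (isMagma)
open import Relation.Nullary.Decidable using (⌊_⌋; yes; no; toWitness)
open import Relation.Nullary.Negation using (contradiction)
open import Tactic.RingSolver using (solve-∀)
open import Tactic.RingSolver.Core.AlmostCommutativeRing
  using (AlmostCommutativeRing; fromCommutativeRing)

open ≡-Reasoning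

false≟ : ∀ b → Maybe (false ≡ b)
false≟ false = just refl
false≟ true  = nothing

𝔽₂ : AlmostCommutativeRing 0ℓ 0ℓ
𝔽₂ = fromCommutativeRing xor-∧-commutativeRing false≟

xor-cancelˡ : ∀ a b → a xor (a xor b) ≡ b
xor-cancelˡ = solve-∀ 𝔽₂

xor≡false⇒≡ : ∀ {a b} → a xor b ≡ false → a ≡ b
xor≡false⇒≡ {a} {b} a⊕b≡0 =
  trans (sym (xor-identityʳ a)) (trans (cong (a xor_) (sym a⊕b≡0)) (xor-cancelˡ a b))

∨≡xor : ∀ a b → (T a → T b → ⊥) → a ∨ b ≡ a xor b
∨≡xor true  true  disjoint = contradiction _ (disjoint _)
∨≡xor true  false _ = refl
∨≡xor false b     _ = refl

⊕-assoc : ∀ {d} (x y z : Ω d) → (x ⊕ y) ⊕ z ≡ x ⊕ (y ⊕ z)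
⊕-assoc = zipWith-assoc xor-assoc

⊕-comm : ∀ {d} (x y : Ω d) → x ⊕ y ≡ y ⊕ x
⊕-comm = zipWith-comm xor-comm

⊕-identityˡ : ∀ {d} (x : Ω d) → 0Ω ⊕ x ≡ x
⊕-identityˡ = zipWith-identityˡ xor-identityˡ

⊕-identityʳ : ∀ {d} (x : Ω d) → x ⊕ 0Ω ≡ x
⊕-identityʳ = zipWith-identityʳ xor-identityʳ

⊕-self : ∀ {d} (x : Ω d) → x ⊕ x ≡ 0Ω
⊕-self []      = refl
⊕-self (a ∷ x) = cong₂ _∷_ (xor-same a) (⊕-self x)

⊕-commutativeSemigroup : ℕ → CommutativeSemigroup 0ℓ 0ℓ
⊕-commutativeSemigroup d = record
  { _∙_ = _⊕_ {d}
  ; isCommutativeSemigroup = record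
    { isSemigroup = record { isMagma = isMagma _⊕_ ; assoc = ⊕-assoc }
    ; comm        = ⊕-comm
    }
  }

module ⊕ {d : ℕ} = CommutativeSemigroupProperties (⊕-commutativeSemigroup d)

⊕-cancelʳ : ∀ {d} (x y : Ω d) → (x ⊕ y) ⊕ y ≡ x
⊕-cancelʳ x y = begin
  (x ⊕ y) ⊕ y ≡⟨ ⊕-assoc x y y ⟩
  x ⊕ (y ⊕ y) ≡⟨ cong (x ⊕_) (⊕-self y) ⟩
  x ⊕ 0Ω      ≡⟨ ⊕-identityʳ x ⟩
  x           ∎

⊕-cancelˡ : ∀ {d} (x y : Ω d) → x ⊕ (x ⊕ y) ≡ y
⊕-cancelˡ x y = begin
  x ⊕ (x ⊕ y) ≡⟨ ⊕-assoc x x y ⟨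
  (x ⊕ x) ⊕ y ≡⟨ cong (_⊕ y) (⊕-self x) ⟩
  0Ω ⊕ y      ≡⟨ ⊕-identityˡ y ⟩
  y           ∎

⊕-cancelˡ-≡ : ∀ {d} (x : Ω d) {y z} → x ⊕ y ≡ x ⊕ z → y ≡ z
⊕-cancelˡ-≡ x {y} {z} x⊕y≡x⊕z = trans (sym (⊕-cancelˡ x y)) (trans (cong (x ⊕_) x⊕y≡x⊕z) (⊕-cancelˡ x z))

⊕-transpose : ∀ {d} {x y t : Ω d} → x ⊕ t ≡ y → x ≡ y ⊕ t
⊕-transpose {x = x} {t = t} x⊕t≡y = trans (sym (⊕-cancelʳ x t)) (cong (_⊕ t) x⊕t≡y)

⊕≡0Ω⇒≡ : ∀ {d} {x y : Ω d} → x ⊕ y ≡ 0Ω → x ≡ y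
⊕≡0Ω⇒≡ {y = y} x⊕y≡0 = trans (⊕-transpose x⊕y≡0) (⊕-identityˡ y)

Ω-ext : ∀ {d} {x y : Ω d} → (∀ i → lookup x i ≡ lookup y i) → x ≡ y
Ω-ext {x = x} {y} x≗y = begin
  x                  ≡⟨ tabulate∘lookup x ⟨
  tabulate (lookup x) ≡⟨ tabulate-cong x≗y ⟩
  tabulate (lookup y) ≡⟨ tabulate∘lookup y ⟩
  y                  ∎

⁅_⁆ : ∀ {d} → Ω d → Sub d
⁅ y ⁆ x = ⌊ x ≟Ω y ⌋

⁅⁆-cong⇔ : ∀ {d e} {x y : Ω d} {x' y' : Ω e} →
           (x ≡ y → x' ≡ y') → (x' ≡ y' → x ≡ y) → ⁅ y ⁆ x ≡ ⁅ y' ⁆ x'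
⁅⁆-cong⇔ {x = x} {y} {x'} {y'} to from with x ≟Ω y | x' ≟Ω y'
... | yes _   | yes _    = refl
... | yes x≡y | no x'≢y' = contradiction (to x≡y) x'≢y'
... | no x≢y  | yes x'≡y' = contradiction (from x'≡y') x≢y
... | no _    | no _     = refl

⁅⁆-sym : ∀ {d} (x y : Ω d) → ⁅ y ⁆ x ≡ ⁅ x ⁆ y
⁅⁆-sym x y = ⁅⁆-cong⇔ sym sym

⁅⁆-∷ : ∀ {d} b (x y : Ω d) → ⁅ b ∷ y ⁆ (b ∷ x) ≡ ⁅ y ⁆ x
⁅⁆-∷ b x y = ⁅⁆-cong⇔ ∷-injectiveʳ (cong (b ∷_))

⁅⁆-shift : ∀ {d} (x y t : Ω d) → ⁅ y ⁆ (x ⊕ t) ≡ ⁅ y ⊕ t ⁆ x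
⁅⁆-shift x y t = ⁅⁆-cong⇔ ⊕-transpose (λ x≡y⊕t → trans (cong (_⊕ t) x≡y⊕t) (⊕-cancelʳ y t))

-- Summation over Ω d in 𝔽₂

∑ : (d : ℕ) → (Ω d → Bool) → Bool
∑ zero    F = F []
∑ (suc d) F = ∑ d (F ∘ (false ∷_)) xor ∑ d (F ∘ (true ∷_))

∑-cong : ∀ {d} {F G : Ω d → Bool} → (∀ x → F x ≡ G x) → ∑ d F ≡ ∑ d G
∑-cong {zero}  F≗G = F≗G []
∑-cong {suc d} F≗G = cong₂ _xor_ (∑-cong (F≗G ∘ (false ∷_))) (∑-cong (F≗G ∘ (true ∷_)))

∑-false : ∀ d → ∑ d (λ _ → false) ≡ false
∑-false zero    = refl
∑-false (suc d) = xor-same (∑ d (λ _ → false))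

∑-xor : ∀ {d} (F G : Ω d → Bool) → ∑ d (λ x → F x xor G x) ≡ ∑ d F xor ∑ d G
∑-xor {zero}  F G = refl
∑-xor {suc d} F G = begin
  ∑ (suc d) (λ x → F x xor G x) ≡⟨ cong₂ _xor_ (∑-xor (F ∘ (false ∷_)) (G ∘ (false ∷_)))
                                                 (∑-xor (F ∘ (true ∷_)) (G ∘ (true ∷_))) ⟩
  (F₀ xor G₀) xor (F₁ xor G₁)    ≡⟨ interchange F₀ G₀ F₁ G₁ ⟩
  (F₀ xor F₁) xor (G₀ xor G₁)    ∎
  where
  F₀ = ∑ d (F ∘ (false ∷_)); F₁ = ∑ d (F ∘ (true ∷_))
  G₀ = ∑ d (G ∘ (false ∷_)); G₁ = ∑ d (G ∘ (true ∷_))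
  interchange : ∀ a b c e → (a xor b) xor (c xor e) ≡ (a xor c) xor (b xor e)
  interchange = solve-∀ 𝔽₂

∑-∧ʳ : ∀ {d} (F : Ω d → Bool) b → ∑ d (λ x → F x ∧ b) ≡ ∑ d F ∧ b
∑-∧ʳ {zero}  F b = refl
∑-∧ʳ {suc d} F b =
  trans (cong₂ _xor_ (∑-∧ʳ (F ∘ (false ∷_)) b) (∑-∧ʳ (F ∘ (true ∷_)) b))
        (sym (∧-distribʳ-xor b (∑ d (F ∘ (false ∷_))) (∑ d (F ∘ (true ∷_)))))

∑-swap : ∀ {m d} (F : Ω m → Ω d → Bool) →
         ∑ m (λ a → ∑ d (F a)) ≡ ∑ d (λ x → ∑ m (λ a → F a x))
∑-swap {zero}  F = refl
∑-swap {suc m} {d} F =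
  trans (cong₂ _xor_ (∑-swap (F ∘ (false ∷_))) (∑-swap (F ∘ (true ∷_))))
        (sym (∑-xor (λ x → ∑ m (λ a → F (false ∷ a) x)) (λ x → ∑ m (λ a → F (true ∷ a) x))))

∑-sift : ∀ {d} (y : Ω d) (F : Ω d → Bool) → ∑ d (λ x → ⁅ y ⁆ x ∧ F x) ≡ F y
∑-sift []                  F = refl
∑-sift {suc d} (false ∷ y) F = begin
  ∑ d (λ x → ⁅ false ∷ y ⁆ (false ∷ x) ∧ F (false ∷ x)) xor ∑ d (λ _ → false)
    ≡⟨ cong₂ _xor_ (∑-cong (λ x → cong (_∧ F (false ∷ x)) (⁅⁆-∷ false x y))) (∑-false d) ⟩
  ∑ d (λ x → ⁅ y ⁆ x ∧ F (false ∷ x)) xor false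
    ≡⟨ xor-identityʳ _ ⟩
  ∑ d (λ x → ⁅ y ⁆ x ∧ F (false ∷ x))
    ≡⟨ ∑-sift y (F ∘ (false ∷_)) ⟩
  F (false ∷ y) ∎
∑-sift {suc d} (true ∷ y)  F =
  cong₂ _xor_ (∑-false d)
    (trans (∑-cong (λ x → cong (_∧ F (true ∷ x)) (⁅⁆-∷ true x y))) (∑-sift y (F ∘ (true ∷_))))

∑-translate : ∀ {d} (c : Ω d) (F : Ω d → Bool) → ∑ d (λ x → F (x ⊕ c)) ≡ ∑ d F
∑-translate []          F = refl
∑-translate (false ∷ c) F =
  cong₂ _xor_ (∑-translate c (F ∘ (false ∷_))) (∑-translate c (F ∘ (true ∷_)))
∑-translate {suc d} (true ∷ c)  F =
  trans (cong₂ _xor_ (∑-translate c (F ∘ (true ∷_))) (∑-translate c (F ∘ (false ∷_))))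
        (xor-comm (∑ d (F ∘ (true ∷_))) (∑ d (F ∘ (false ∷_))))

xorSum : List Bool → Bool
xorSum = foldr _xor_ false

xorSum-++ : ∀ bs cs → xorSum (bs ++ cs) ≡ xorSum bs xor xorSum cs
xorSum-++ []       cs = refl
xorSum-++ (b ∷ bs) cs = trans (cong (b xor_) (xorSum-++ bs cs)) (sym (xor-assoc b _ _))

or-++ : ∀ bs cs → or (bs ++ cs) ≡ or bs ∨ or cs
or-++ []       cs = refl
or-++ (b ∷ bs) cs = trans (cong (b ∨_) (or-++ bs cs)) (sym (∨-assoc b _ _))

map-allVecs-suc : ∀ {m} {A : Set} (F : Ω (suc m) → A) →
  map F (allVecs (suc m)) ≡ map (F ∘ (false ∷_)) (allVecs m) ++ map (F ∘ (true ∷_)) (allVecs m)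
map-allVecs-suc {m} F = trans (map-++ F (map (false ∷_) (allVecs m)) _)
  (sym (cong₂ _++_ (map-∘ {g = F} (allVecs m)) (map-∘ {g = F} (allVecs m))))

∑-allVecs : ∀ {d} (F : Ω d → Bool) → xorSum (map F (allVecs d)) ≡ ∑ d F
∑-allVecs {zero}  F = xor-identityʳ (F [])
∑-allVecs {suc d} F = begin
  xorSum (map F (allVecs (suc d)))
    ≡⟨ cong xorSum (map-allVecs-suc F) ⟩
  xorSum (map (F ∘ (false ∷_)) (allVecs d) ++ map (F ∘ (true ∷_)) (allVecs d))
    ≡⟨ xorSum-++ (map (F ∘ (false ∷_)) (allVecs d)) _ ⟩
  xorSum (map (F ∘ (false ∷_)) (allVecs d)) xor xorSum (map (F ∘ (true ∷_)) (allVecs d))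
    ≡⟨ cong₂ _xor_ (∑-allVecs (F ∘ (false ∷_))) (∑-allVecs (F ∘ (true ∷_))) ⟩
  ∑ (suc d) F ∎

any-allVecs-suc : ∀ {m} (F : Ω (suc m) → Bool) →
  any F (allVecs (suc m)) ≡ any (F ∘ (false ∷_)) (allVecs m) ∨ any (F ∘ (true ∷_)) (allVecs m)
any-allVecs-suc {m} F = trans (cong or (map-allVecs-suc F)) (or-++ (map (F ∘ (false ∷_)) (allVecs m)) _)

any-allVecs≡∑ : ∀ {m} (F : Ω m → Bool) → (∀ {a b} → T (F a) → T (F b) → a ≡ b) →
  any F (allVecs m) ≡ ∑ m F
any-allVecs≡∑ {zero}  F unique = ∨-identityʳ (F [])
any-allVecs≡∑ {suc m} F unique = begin
  any F (allVecs (suc m))   ≡⟨ any-allVecs-suc F ⟩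
  any F₀ (allVecs m) ∨ any F₁ (allVecs m)
    ≡⟨ ∨≡xor _ _ disjoint ⟩
  any F₀ (allVecs m) xor any F₁ (allVecs m)
    ≡⟨ cong₂ _xor_ (any-allVecs≡∑ F₀ (λ p q → ∷-injectiveʳ (unique p q)))
                   (any-allVecs≡∑ F₁ (λ p q → ∷-injectiveʳ (unique p q))) ⟩
  ∑ (suc m) F ∎
  where
  F₀ = F ∘ (false ∷_); F₁ = F ∘ (true ∷_)
  disjoint : T (any F₀ (allVecs m)) → T (any F₁ (allVecs m)) → ⊥
  disjoint p q with satisfied (any⁻ F₀ (allVecs m) p) | satisfied (any⁻ F₁ (allVecs m) q)
  ... | _ , F₀a | _ , F₁b with ∷-injectiveˡ (unique F₀a F₁b)
  ... | ()

odd : ℕ → Bool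
odd zero    = false
odd (suc n) = not (odd n)

odd-+ : ∀ m n → odd (m + n) ≡ odd m xor odd n
odd-+ zero    n = refl
odd-+ (suc m) n = trans (cong not (odd-+ m n)) (not-distribˡ-xor (odd m) (odd n))

odd-sum : ∀ ns → odd (sum ns) ≡ xorSum (map odd ns)
odd-sum []       = refl
odd-sum (n ∷ ns) = trans (odd-+ n (sum ns)) (cong (odd n xor_) (odd-sum ns))

odd-card : ∀ {d} (X : Sub d) → odd (card X) ≡ ∑ d X
odd-card {d} X = begin
  odd (sum (map indicator (allVecs d)))       ≡⟨ odd-sum (map indicator (allVecs d)) ⟩
  xorSum (map odd (map indicator (allVecs d))) ≡⟨ cong xorSum (map-∘ (allVecs d)) ⟨
  xorSum (map (odd ∘ indicator) (allVecs d))  ≡⟨ cong xorSum (map-cong odd-indicator (allVecs d)) ⟩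
  xorSum (map X (allVecs d))                  ≡⟨ ∑-allVecs X ⟩
  ∑ d X ∎
  where
  indicator : Ω d → ℕ
  indicator x = if X x then 1 else 0
  odd-indicator : ∀ x → odd (indicator x) ≡ X x
  odd-indicator x with X x
  ... | true  = refl
  ... | false = refl

2∣⇒¬odd : ∀ n → 2 ∣ n → odd n ≡ false
2∣⇒¬odd _ (divides q refl) = odd-double q
  where
  odd-double : ∀ q → odd (q * 2) ≡ false
  odd-double zero    = refl
  odd-double (suc q) = trans (not-involutive _) (odd-double q)

¬odd⇒2∣ : ∀ n → odd n ≡ false → 2 ∣ n
¬odd⇒2∣ zero          _ = divides 0 refl
¬odd⇒2∣ (suc zero)    ()
¬odd⇒2∣ (suc (suc n)) even with ¬odd⇒2∣ n (trans (sym (not-involutive (odd n))) even)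
... | divides q n≡q*2 = divides (suc q) (cong (suc ∘ suc) n≡q*2)

¬2∣⇒odd : ∀ n → ¬ 2 ∣ n → odd n ≡ true
¬2∣⇒odd n ¬2∣n with odd n in eq
... | true  = refl
... | false = contradiction (¬odd⇒2∣ n eq) ¬2∣n

-- Affine subspaces

affineSet : ∀ {d m} → Ω d → Vec (Ω d) m → Sub d
affineSet {m = m} b vs x = any (λ ls → ⁅ b ⊕ lincomb ls vs ⁆ x) (allVecs m)

sumOf : ∀ {d} → List (AffSub d) → Sub d
sumOf As x = foldr (λ A b → ⟦ A ⟧ x xor b) false As

affineSet-translate : ∀ {d m} (b : Ω d) (vs : Vec (Ω d) m) (x t : Ω d) →
                      affineSet b vs (x ⊕ t) ≡ affineSet (b ⊕ t) vs x
affineSet-translate {m = m} b vs x t = cong or (map-cong shift (allVecs m))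
  where
  shift : ∀ ls → ⁅ b ⊕ lincomb ls vs ⁆ (x ⊕ t) ≡ ⁅ (b ⊕ t) ⊕ lincomb ls vs ⁆ x
  shift ls = trans (⁅⁆-shift x _ t) (cong (λ p → ⁅ p ⁆ x) (⊕.xy∙z≈xz∙y b (lincomb ls vs) t))

affineSet-translates : ∀ {d m} (b b' : Ω d) (vs : Vec (Ω d) m) →
                       IsTranslate (affineSet b' vs) (affineSet b vs)
affineSet-translates b b' vs = b ⊕ b' , λ x → sym (begin
  affineSet b vs (x ⊕ (b ⊕ b'))  ≡⟨ affineSet-translate b vs x (b ⊕ b') ⟩
  affineSet (b ⊕ (b ⊕ b')) vs x  ≡⟨ cong (λ p → affineSet p vs x) (⊕-cancelˡ b b') ⟩
  affineSet b' vs x              ∎)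

affineSet-invariant : ∀ {d m} (b v : Ω d) (vs : Vec (Ω d) m) → Invariant v (affineSet b (v ∷ vs))
affineSet-invariant {m = m} b v vs x = begin
  affineSet b (v ∷ vs) (x ⊕ v)          ≡⟨ affineSet-translate b (v ∷ vs) x v ⟩
  affineSet (b ⊕ v) (v ∷ vs) x          ≡⟨ any-allVecs-suc (λ ls → ⁅ (b ⊕ v) ⊕ lincomb ls (v ∷ vs) ⁆ x) ⟩
  any F₀ (allVecs m) ∨ any F₁ (allVecs m) ≡⟨ cong₂ _∨_ (cong or (map-cong F₀≗G₁ (allVecs m)))
                                                     (cong or (map-cong F₁≗G₀ (allVecs m))) ⟩
  any G₁ (allVecs m) ∨ any G₀ (allVecs m) ≡⟨ ∨-comm (any G₁ (allVecs m)) _ ⟩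
  any G₀ (allVecs m) ∨ any G₁ (allVecs m) ≡⟨ any-allVecs-suc (λ ls → ⁅ b ⊕ lincomb ls (v ∷ vs) ⁆ x) ⟨
  affineSet b (v ∷ vs) x                ∎
  where
  F₀ F₁ G₀ G₁ : Ω m → Bool
  F₀ ls = ⁅ (b ⊕ v) ⊕ lincomb ls vs ⁆ x
  F₁ ls = ⁅ (b ⊕ v) ⊕ (v ⊕ lincomb ls vs) ⁆ x
  G₀ ls = ⁅ b ⊕ lincomb ls vs ⁆ x
  G₁ ls = ⁅ b ⊕ (v ⊕ lincomb ls vs) ⁆ x
  F₀≗G₁ : ∀ ls → F₀ ls ≡ G₁ ls
  F₀≗G₁ ls = cong (λ p → ⁅ p ⁆ x) (⊕-assoc b v (lincomb ls vs))
  F₁≗G₀ : ∀ ls → F₁ ls ≡ G₀ ls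
  F₁≗G₀ ls = cong (λ p → ⁅ p ⁆ x) (trans (⊕-assoc b v _) (cong (b ⊕_) (⊕-cancelˡ v (lincomb ls vs))))

lincomb-⊕ : ∀ {m d} (a a' : Ω m) (vs : Vec (Ω d) m) →
            lincomb (a ⊕ a') vs ≡ lincomb a vs ⊕ lincomb a' vs
lincomb-⊕ []          []           []       = sym (⊕-identityˡ 0Ω)
lincomb-⊕ (false ∷ a) (false ∷ a') (v ∷ vs) = lincomb-⊕ a a' vs
lincomb-⊕ (false ∷ a) (true ∷ a')  (v ∷ vs) =
  trans (cong (v ⊕_) (lincomb-⊕ a a' vs)) (⊕.x∙yz≈y∙xz v (lincomb a vs) (lincomb a' vs))
lincomb-⊕ (true ∷ a)  (false ∷ a') (v ∷ vs) =
  trans (cong (v ⊕_) (lincomb-⊕ a a' vs)) (sym (⊕-assoc v (lincomb a vs) (lincomb a' vs)))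
lincomb-⊕ (true ∷ a)  (true ∷ a')  (v ∷ vs) = begin
  lincomb (a ⊕ a') vs                           ≡⟨ lincomb-⊕ a a' vs ⟩
  lincomb a vs ⊕ lincomb a' vs                  ≡⟨ ⊕-identityˡ _ ⟨
  0Ω ⊕ (lincomb a vs ⊕ lincomb a' vs)           ≡⟨ cong (_⊕ _) (⊕-self v) ⟨
  (v ⊕ v) ⊕ (lincomb a vs ⊕ lincomb a' vs)      ≡⟨ ⊕.interchange v v (lincomb a vs) (lincomb a' vs) ⟩
  (v ⊕ lincomb a vs) ⊕ (v ⊕ lincomb a' vs)      ∎

lincomb-injective : ∀ {m d} {vs : Vec (Ω d) m} → LinIndep vs →
                    ∀ {a a'} → lincomb a vs ≡ lincomb a' vs → a ≡ a'
lincomb-injective {vs = vs} indep {a} {a'} eq = ⊕≡0Ω⇒≡ (indep (a ⊕ a') (begin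
  lincomb (a ⊕ a') vs            ≡⟨ lincomb-⊕ a a' vs ⟩
  lincomb a vs ⊕ lincomb a' vs   ≡⟨ cong (_⊕ lincomb a' vs) eq ⟩
  lincomb a' vs ⊕ lincomb a' vs  ≡⟨ ⊕-self (lincomb a' vs) ⟩
  0Ω                             ∎))

⟦⟧≡∑ : ∀ {d} (A : AffSub d) (x : Ω d) →
       ⟦ A ⟧ x ≡ ∑ (dim A) (λ ls → ⁅ base A ⊕ lincomb ls (dirs A) ⁆ x)
⟦⟧≡∑ A x = any-allVecs≡∑ _ λ p q →
  lincomb-injective (indep A) (⊕-cancelˡ-≡ (base A) (trans (sym (toWitness p)) (toWitness q)))

line : ∀ {d} (b u : Ω d) → LinIndep (u ∷ []) → AffSub d
line b u indep = record { dim = 1 ; base = b ; dirs = u ∷ [] ; indep = indep }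

-- σ[ i ] S is the i-th coordinate of Σ_{x ∈ S} x.

σ[_] : ∀ {d} → Fin d → Sub d → Bool
σ[_] {d} i S = ∑ d (λ x → S x ∧ lookup x i)

σ-cong : ∀ {d} (i : Fin d) {S S' : Sub d} → (∀ x → S x ≡ S' x) → σ[ i ] S ≡ σ[ i ] S'
σ-cong i S≗S' = ∑-cong (λ x → cong (_∧ lookup x i) (S≗S' x))

σ-⊕ₛ : ∀ {d} (i : Fin d) (S S' : Sub d) → σ[ i ] (S ⊕ₛ S') ≡ σ[ i ] S xor σ[ i ] S'
σ-⊕ₛ i S S' = trans (∑-cong (λ x → ∧-distribʳ-xor (lookup x i) (S x) (S' x)))
                    (∑-xor (λ x → S x ∧ lookup x i) (λ x → S' x ∧ lookup x i))

σ-⟦⟧ : ∀ {d} (i : Fin d) (A : AffSub d) →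
       σ[ i ] ⟦ A ⟧ ≡ ∑ (dim A) (λ ls → lookup (base A ⊕ lincomb ls (dirs A)) i)
σ-⟦⟧ {d} i A = begin
  ∑ d (λ x → ⟦ A ⟧ x ∧ lookup x i)                    ≡⟨ ∑-cong (λ x → cong (_∧ lookup x i) (⟦⟧≡∑ A x)) ⟩
  ∑ d (λ x → ∑ (dim A) (λ ls → ⁅ p ls ⁆ x) ∧ lookup x i) ≡⟨ ∑-cong (λ x → sym (∑-∧ʳ (λ ls → ⁅ p ls ⁆ x) _)) ⟩
  ∑ d (λ x → ∑ (dim A) (λ ls → ⁅ p ls ⁆ x ∧ lookup x i)) ≡⟨ ∑-swap (λ ls x → ⁅ p ls ⁆ x ∧ lookup x i) ⟨
  ∑ (dim A) (λ ls → ∑ d (λ x → ⁅ p ls ⁆ x ∧ lookup x i)) ≡⟨ ∑-cong (λ ls → ∑-sift (p ls) (λ x → lookup x i)) ⟩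
  ∑ (dim A) (λ ls → lookup (p ls) i)                   ∎
  where
  p : Ω (dim A) → Ω d
  p ls = base A ⊕ lincomb ls (dirs A)

-- Pairing the parameters ls and v + ls kills everything but the direction v.
∑-coordinate-affine : ∀ {m d} (i : Fin d) (b v : Ω d) (vs : Vec (Ω d) m) →
  ∑ (suc m) (λ ls → lookup (b ⊕ lincomb ls (v ∷ vs)) i) ≡ ∑ m (λ _ → lookup v i)
∑-coordinate-affine i b v vs = trans
  (sym (∑-xor (λ ls → lookup (b ⊕ lincomb ls vs) i) (λ ls → lookup (b ⊕ (v ⊕ lincomb ls vs)) i)))
  (∑-cong pair)
  where
  cancel : ∀ p q r → (p xor q) xor (p xor (r xor q)) ≡ r
  cancel = solve-∀ 𝔽₂
  pair : ∀ ls → lookup (b ⊕ lincomb ls vs) i xor lookup (b ⊕ (v ⊕ lincomb ls vs)) i ≡ lookup v i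
  pair ls rewrite lookup-zipWith _xor_ i b (lincomb ls vs)
                | lookup-zipWith _xor_ i b (v ⊕ lincomb ls vs)
                | lookup-zipWith _xor_ i v (lincomb ls vs)
                = cancel (lookup b i) (lookup (lincomb ls vs) i) (lookup v i)

σ-line : ∀ {d} (i : Fin d) (b u : Ω d) (indep : LinIndep (u ∷ [])) → σ[ i ] ⟦ line b u indep ⟧ ≡ lookup u i
σ-line i b u indep = trans (σ-⟦⟧ i (line b u indep)) (∑-coordinate-affine i b u [])

σ-dim≥2 : ∀ {d} (i : Fin d) (A : AffSub d) → 2 ≤ dim A → σ[ i ] ⟦ A ⟧ ≡ false
σ-dim≥2 i record { dim = zero }      ()
σ-dim≥2 i record { dim = suc zero }  (s≤s ())
σ-dim≥2 i A@record { dim = suc (suc m) ; base = b ; dirs = v ∷ vs } _ =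
  trans (σ-⟦⟧ i A) (trans (∑-coordinate-affine i b v vs) (xor-same (∑ m (λ _ → lookup v i))))

σ-sumOf : ∀ {d} (i : Fin d) {As : List (AffSub d)} → All (λ A → 2 ≤ dim A) As → σ[ i ] (sumOf As) ≡ false
σ-sumOf {d} i []           = ∑-false d
σ-sumOf i {A ∷ As} (h ∷ hs) = begin
  σ[ i ] (⟦ A ⟧ ⊕ₛ sumOf As)          ≡⟨ σ-⊕ₛ i ⟦ A ⟧ (sumOf As) ⟩
  σ[ i ] ⟦ A ⟧ xor σ[ i ] (sumOf As)  ≡⟨ cong₂ _xor_ (σ-dim≥2 i A h) (σ-sumOf i hs) ⟩
  false                               ∎

σ-RM : ∀ {d} (i : Fin d) (S : Sub d) → RM ((+ d) - (+ 2)) d S → σ[ i ] S ≡ false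
σ-RM {suc zero}    i S S≡∅ = trans (σ-cong i S≡∅) (∑-false 1)
σ-RM {suc (suc k)} i S (As , codim , S≡ΣAs) =
  trans (σ-cong i S≡ΣAs) (σ-sumOf i (All.map (+-cancelʳ-≤ k 2 _) codim))

σ-Xτ-1 : ∀ {d} (i : Fin d) (c : Ω d) (X : Sub d) → σ[ i ] (Xτ-1 c X) ≡ ∑ d X ∧ lookup c i
σ-Xτ-1 {d} i c X = begin
  σ[ i ] (X ⊕ₛ (X τ[ c ]))              ≡⟨ σ-⊕ₛ i X (X τ[ c ]) ⟩
  σ[ i ] X xor σ[ i ] (X τ[ c ])        ≡⟨ cong (σ[ i ] X xor_) σ-Xτ ⟩
  σ[ i ] X xor (σ[ i ] X xor (∑ d X ∧ lookup c i)) ≡⟨ xor-cancelˡ (σ[ i ] X) _ ⟩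
  ∑ d X ∧ lookup c i                    ∎
  where
  σ-Xτ : σ[ i ] (X τ[ c ]) ≡ σ[ i ] X xor (∑ d X ∧ lookup c i)
  σ-Xτ = begin
    ∑ d (λ x → X (x ⊕ c) ∧ lookup x i)
      ≡⟨ ∑-cong (λ x → cong (λ z → X (x ⊕ c) ∧ lookup z i) (sym (⊕-cancelʳ x c))) ⟩
    ∑ d (λ x → X (x ⊕ c) ∧ lookup ((x ⊕ c) ⊕ c) i)
      ≡⟨ ∑-translate c (λ y → X y ∧ lookup (y ⊕ c) i) ⟩
    ∑ d (λ y → X y ∧ lookup (y ⊕ c) i)
      ≡⟨ ∑-cong (λ y → trans (cong (X y ∧_) (lookup-zipWith _xor_ i y c)) (∧-distribˡ-xor (X y) _ _)) ⟩
    ∑ d (λ y → (X y ∧ lookup y i) xor (X y ∧ lookup c i))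
      ≡⟨ ∑-xor (λ y → X y ∧ lookup y i) (λ y → X y ∧ lookup c i) ⟩
    σ[ i ] X xor ∑ d (λ y → X y ∧ lookup c i)
      ≡⟨ cong (σ[ i ] X xor_) (∑-∧ʳ X (lookup c i)) ⟩
    σ[ i ] X xor (∑ d X ∧ lookup c i) ∎

coset-line-direction : ∀ {d} (c : Ω d) (X : Sub d) → ∑ d X ≡ true →
  (b u : Ω d) (indep : LinIndep (u ∷ [])) →
  InCoset ⟦ line b u indep ⟧ ((+ d) - (+ 2)) (Xτ-1 c X) → u ≡ c
coset-line-direction c X odd b u indep Xτ-1+Q∈RM = sym (Ω-ext λ i → xor≡false⇒≡ (begin
  lookup c i xor lookup u i             ≡⟨ cong₂ _xor_ (trans (σ-Xτ-1 i c X) (cong (_∧ lookup c i) odd))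
                                                       (σ-line i b u indep) ⟨
  σ[ i ] (Xτ-1 c X) xor σ[ i ] ⟦ Q ⟧    ≡⟨ σ-⊕ₛ i (Xτ-1 c X) ⟦ Q ⟧ ⟨
  σ[ i ] (Xτ-1 c X ⊕ₛ ⟦ Q ⟧)            ≡⟨ σ-RM i _ Xτ-1+Q∈RM ⟩
  false                                 ∎))
  where
  Q : AffSub _
  Q = line b u indep

-- Planes through the direction c

span₁ : ∀ {d} → Ω d → Sub d
span₁ c y = ⁅ 0Ω ⁆ y xor ⁅ c ⁆ y

-- span₂ c x = {0, x, c, c + x} as a sum of singletons: the plane ⟨c, x⟩ unless x ∈ {0, c}.
span₂ : ∀ {d} → Ω d → Ω d → Sub d
span₂ c x y = (⁅ 0Ω ⁆ y xor ⁅ x ⁆ y) xor (⁅ c ⁆ y xor ⁅ c ⊕ x ⁆ y)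

span₂-zero : ∀ {d} (c y : Ω d) → span₂ c 0Ω y ≡ false
span₂-zero c y = trans (cong (λ p → (⁅ 0Ω ⁆ y xor ⁅ 0Ω ⁆ y) xor (⁅ c ⁆ y xor ⁅ p ⁆ y)) (⊕-identityʳ c))
                       (vanish (⁅ 0Ω ⁆ y) (⁅ c ⁆ y))
  where
  vanish : ∀ a b → (a xor a) xor (b xor b) ≡ false
  vanish = solve-∀ 𝔽₂

span₂-self : ∀ {d} (c y : Ω d) → span₂ c c y ≡ false
span₂-self c y = trans (cong (λ p → (⁅ 0Ω ⁆ y xor ⁅ c ⁆ y) xor (⁅ c ⁆ y xor ⁅ p ⁆ y)) (⊕-self c))
                       (vanish (⁅ 0Ω ⁆ y) (⁅ c ⁆ y))
  where
  vanish : ∀ a b → (a xor b) xor (b xor a) ≡ false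
  vanish = solve-∀ 𝔽₂

∑-span₂ : ∀ {d} (c : Ω d) (X : Sub d) (y : Ω d) →
          ∑ d (λ x → X x ∧ span₂ c x y) ≡ Xτ-1 c X y xor (∑ d X ∧ span₁ c y)
∑-span₂ {d} c X y = begin
  ∑ d (λ x → X x ∧ span₂ c x y)
    ≡⟨ ∑-cong (λ x → distribute (X x) (⁅ 0Ω ⁆ y) (⁅ x ⁆ y) (⁅ c ⁆ y) (⁅ c ⊕ x ⁆ y)) ⟩
  ∑ d (λ x → (⁅ x ⁆ y ∧ X x xor ⁅ c ⊕ x ⁆ y ∧ X x) xor (X x ∧ span₁ c y))
    ≡⟨ ∑-xor (λ x → ⁅ x ⁆ y ∧ X x xor ⁅ c ⊕ x ⁆ y ∧ X x) (λ x → X x ∧ span₁ c y) ⟩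
  ∑ d (λ x → ⁅ x ⁆ y ∧ X x xor ⁅ c ⊕ x ⁆ y ∧ X x) xor ∑ d (λ x → X x ∧ span₁ c y)
    ≡⟨ cong₂ _xor_ (∑-xor (λ x → ⁅ x ⁆ y ∧ X x) (λ x → ⁅ c ⊕ x ⁆ y ∧ X x)) (∑-∧ʳ X (span₁ c y)) ⟩
  (∑ d (λ x → ⁅ x ⁆ y ∧ X x) xor ∑ d (λ x → ⁅ c ⊕ x ⁆ y ∧ X x)) xor (∑ d X ∧ span₁ c y)
    ≡⟨ cong (λ p → p xor (∑ d X ∧ span₁ c y)) (cong₂ _xor_ sift₀ sift₁) ⟩
  (X y xor X (y ⊕ c)) xor (∑ d X ∧ span₁ c y) ∎
  where
  distribute : ∀ a p q r s →
    a ∧ ((p xor q) xor (r xor s)) ≡ (q ∧ a xor s ∧ a) xor (a ∧ (p xor r))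
  distribute = solve-∀ 𝔽₂
  sift₀ : ∑ d (λ x → ⁅ x ⁆ y ∧ X x) ≡ X y
  sift₀ = trans (∑-cong (λ x → cong (_∧ X x) (⁅⁆-sym y x))) (∑-sift y X)
  sift₁ : ∑ d (λ x → ⁅ c ⊕ x ⁆ y ∧ X x) ≡ X (y ⊕ c)
  sift₁ = trans (∑-cong (λ x → cong (_∧ X x) (begin
            ⁅ c ⊕ x ⁆ y  ≡⟨ ⁅⁆-sym y (c ⊕ x) ⟩
            ⁅ y ⁆ (c ⊕ x) ≡⟨ cong ⁅ y ⁆ (⊕-comm c x) ⟩
            ⁅ y ⁆ (x ⊕ c) ≡⟨ ⁅⁆-shift x y c ⟩
            ⁅ y ⊕ c ⁆ x  ∎)))
          (∑-sift (y ⊕ c) X)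

module _ {d} (c : Ω d) (c≢0 : c ≢ 0Ω) where

  line₀ : AffSub d
  line₀ = line 0Ω c independent
    where
    independent : LinIndep (c ∷ [])
    independent (false ∷ []) _      = refl
    independent (true ∷ [])  c⊕0≡0 = contradiction (trans (sym (⊕-identityʳ c)) c⊕0≡0) c≢0

  ⟦line₀⟧ : ∀ y → ⟦ line₀ ⟧ y ≡ span₁ c y
  ⟦line₀⟧ y = trans (⟦⟧≡∑ line₀ y)
    (cong₂ (λ p q → ⁅ p ⁆ y xor ⁅ q ⁆ y) (⊕-identityˡ 0Ω) (trans (⊕-identityˡ _) (⊕-identityʳ c)))

  plane : (x : Ω d) → x ≢ 0Ω → x ≢ c → AffSub d
  plane x x≢0 x≢c = record { dim = 2 ; base = 0Ω ; dirs = c ∷ x ∷ [] ; indep = independent }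
    where
    independent : LinIndep (c ∷ x ∷ [])
    independent (false ∷ false ∷ []) _  = refl
    independent (false ∷ true ∷ [])  eq = contradiction (trans (sym (⊕-identityʳ x)) eq) x≢0
    independent (true ∷ false ∷ [])  eq = contradiction (trans (sym (⊕-identityʳ c)) eq) c≢0
    independent (true ∷ true ∷ [])   eq = contradiction (sym (trans (⊕≡0Ω⇒≡ eq) (⊕-identityʳ x))) x≢c

  ⟦plane⟧ : ∀ x x≢0 x≢c y → ⟦ plane x x≢0 x≢c ⟧ y ≡ span₂ c x y
  ⟦plane⟧ x x≢0 x≢c y = trans (⟦⟧≡∑ (plane x x≢0 x≢c) y)
    (cong₂ _xor_ (cong₂ (λ p q → ⁅ p ⁆ y xor ⁅ q ⁆ y) (⊕-identityˡ 0Ω) (trans (⊕-identityˡ _) (⊕-identityʳ x)))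
                 (cong₂ (λ p q → ⁅ p ⁆ y xor ⁅ q ⁆ y) (trans (⊕-identityˡ _) (⊕-identityʳ c))
                                                    (trans (⊕-identityˡ _) (cong (c ⊕_) (⊕-identityʳ x)))))

  planes : Sub d → List (Ω d) → List (AffSub d)
  planes X [] = []
  planes X (x ∷ xs) with X x | x ≟Ω 0Ω | x ≟Ω c
  ... | true | no x≢0 | no x≢c = plane x x≢0 x≢c ∷ planes X xs
  ... | _    | _      | _      = planes X xs

  planes-dim : ∀ X xs → All (λ A → dim A ≡ 2) (planes X xs)
  planes-dim X [] = []
  planes-dim X (x ∷ xs) with X x | x ≟Ω 0Ω | x ≟Ω c
  ... | true  | no _    | no _  = refl ∷ planes-dim X xs
  ... | true  | yes _   | _     = planes-dim X xs
  ... | true  | no _    | yes _ = planes-dim X xs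
  ... | false | _       | _     = planes-dim X xs

  sumOf-planes : ∀ X xs y → sumOf (planes X xs) y ≡ xorSum (map (λ x → X x ∧ span₂ c x y) xs)
  sumOf-planes X [] y = refl
  sumOf-planes X (x ∷ xs) y with X x | x ≟Ω 0Ω | x ≟Ω c
  ... | true  | no x≢0   | no x≢c   = cong₂ _xor_ (⟦plane⟧ x x≢0 x≢c y) (sumOf-planes X xs y)
  ... | true  | yes refl | _        = cong₂ _xor_ (sym (span₂-zero c y)) (sumOf-planes X xs y)
  ... | true  | no _     | yes refl = cong₂ _xor_ (sym (span₂-self c y)) (sumOf-planes X xs y)
  ... | false | _        | _        = sumOf-planes X xs y

RM-resp : ∀ {k d} {S S' : Sub d} → (∀ x → S x ≡ S' x) → RM k d S → RM k d S'
RM-resp {k = -[1+ _ ]} S≗S' S≡∅ x = trans (sym (S≗S' x)) (S≡∅ x)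
RM-resp {k = + _}      S≗S' (As , codim , S≡ΣAs) = As , codim , λ x → trans (sym (S≗S' x)) (S≡ΣAs x)

∑-span₂∈RM : ∀ {d} (c : Ω d) → c ≢ 0Ω → (X : Sub d) →
             RM ((+ d) - (+ 2)) d (λ y → ∑ d (λ x → X x ∧ span₂ c x y))
∑-span₂∈RM {zero}        []           c≢0 X = contradiction refl c≢0
∑-span₂∈RM {suc zero}    (false ∷ []) c≢0 X = contradiction refl c≢0
-- For d = 1 the target RM(−1, 1) is 0; indeed Ω = {0, c} yields no plane.
∑-span₂∈RM {suc zero}    c@(true ∷ []) _  X y = cong₂ _xor_
  (trans (cong (X 0Ω ∧_) (span₂-zero c y)) (∧-zeroʳ (X 0Ω)))
  (trans (cong (X c ∧_) (span₂-self c y)) (∧-zeroʳ (X c)))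
∑-span₂∈RM {suc (suc k)} c c≢0 X =
  planes c c≢0 X (allVecs _) ,
  All.map (λ dim≡2 → ≤-reflexive (cong (_+ k) (sym dim≡2))) (planes-dim c c≢0 X (allVecs _)) ,
  λ y → sym (trans (sumOf-planes c c≢0 X (allVecs _) y) (∑-allVecs (λ x → X x ∧ span₂ c x y)))

Xτ-1+∑X·span₁∈RM : ∀ {d} (c : Ω d) → c ≢ 0Ω → (X : Sub d) →
                   RM ((+ d) - (+ 2)) d (λ y → Xτ-1 c X y xor (∑ d X ∧ span₁ c y))
Xτ-1+∑X·span₁∈RM c c≢0 X = RM-resp (∑-span₂ c X) (∑-span₂∈RM c c≢0 X)

Xτ-1∈RM : ∀ {d} (c : Ω d) → c ≢ 0Ω → (X : Sub d) → ∑ d X ≡ false →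
          RM ((+ d) - (+ 2)) d (Xτ-1 c X)
Xτ-1∈RM c c≢0 X even = RM-resp drop-line (Xτ-1+∑X·span₁∈RM c c≢0 X)
  where
  drop-line : ∀ y → Xτ-1 c X y xor (∑ _ X ∧ span₁ c y) ≡ Xτ-1 c X y
  drop-line y = trans (cong (λ p → Xτ-1 c X y xor (p ∧ span₁ c y)) even) (xor-identityʳ _)

Xτ-1∈line₀+RM : ∀ {d} (c : Ω d) (c≢0 : c ≢ 0Ω) (X : Sub d) → ∑ d X ≡ true →
                InCoset ⟦ line₀ c c≢0 ⟧ ((+ d) - (+ 2)) (Xτ-1 c X)
Xτ-1∈line₀+RM c c≢0 X odd = RM-resp to-line₀ (Xτ-1+∑X·span₁∈RM c c≢0 X)
  where
  to-line₀ : ∀ y → Xτ-1 c X y xor (∑ _ X ∧ span₁ c y) ≡ Xτ-1 c X y xor ⟦ line₀ c c≢0 ⟧ y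
  to-line₀ y = trans (cong (λ p → Xτ-1 c X y xor (p ∧ span₁ c y)) odd)
                     (cong (Xτ-1 c X y xor_) (sym (⟦line₀⟧ c c≢0 y)))

coset-lines-parallel : ∀ {d} (c : Ω d) (X : Sub d) → ∑ d X ≡ true →
  (Q Q' : AffSub d) → dim Q ≡ 1 → dim Q' ≡ 1 →
  InCoset ⟦ Q ⟧ ((+ d) - (+ 2)) (Xτ-1 c X) → CosetEq ((+ d) - (+ 2)) ⟦ Q ⟧ ⟦ Q' ⟧ →
  IsTranslate ⟦ Q' ⟧ ⟦ Q ⟧ × Invariant c ⟦ Q ⟧ × Invariant c ⟦ Q' ⟧
coset-lines-parallel c X odd record { base = b  ; dirs = u ∷ []  ; indep = independent }
                             record { base = b' ; dirs = u' ∷ [] ; indep = independent' } refl refl Q∈ Q≈Q' =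
  parallel (coset-line-direction c X odd b u independent Q∈)
           (coset-line-direction c X odd b' u' independent' (proj₁ (Q≈Q' (Xτ-1 c X)) Q∈))
  where
  parallel : ∀ {u u'} → u ≡ c → u' ≡ c →
    IsTranslate (affineSet b' (u' ∷ [])) (affineSet b (u ∷ []))
    × Invariant c (affineSet b (u ∷ [])) × Invariant c (affineSet b' (u' ∷ []))
  parallel refl refl = affineSet-translates b b' (c ∷ []) , affineSet-invariant b c [] , affineSet-invariant b' c []

lemma9p7 : (d : ℕ) → 1 ≤ d → (c : Ω d) → c ≢ 0Ω → (X : Sub d) →
  (2 ∣ card X → RM ((+ d) - (+ 2)) d (Xτ-1 c X))
  × (¬ (2 ∣ card X) → Σ (AffSub d) λ Q → dim Q ≡ 1 × Invariant c ⟦ Q ⟧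
       × InCoset ⟦ Q ⟧ ((+ d) - (+ 2)) (Xτ-1 c X))
  × (¬ (2 ∣ card X) → (Q Q' : AffSub d) → dim Q ≡ 1 → dim Q' ≡ 1
       → InCoset ⟦ Q ⟧ ((+ d) - (+ 2)) (Xτ-1 c X)
       → CosetEq ((+ d) - (+ 2)) ⟦ Q ⟧ ⟦ Q' ⟧
       → IsTranslate ⟦ Q' ⟧ ⟦ Q ⟧ × Invariant c ⟦ Q ⟧ × Invariant c ⟦ Q' ⟧)
lemma9p7 d _ c c≢0 X =
  (λ 2∣|X| → Xτ-1∈RM c c≢0 X (parity-even 2∣|X|)) ,
  (λ ¬2∣|X| → line₀ c c≢0 , refl , affineSet-invariant 0Ω c [] , Xτ-1∈line₀+RM c c≢0 X (parity-odd ¬2∣|X|)) ,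
  (λ ¬2∣|X| → coset-lines-parallel c X (parity-odd ¬2∣|X|))
  where
  parity-even : 2 ∣ card X → ∑ d X ≡ false
  parity-even 2∣|X| = trans (sym (odd-card X)) (2∣⇒¬odd _ 2∣|X|)
  parity-odd : ¬ 2 ∣ card X → ∑ d X ≡ true
  parity-odd ¬2∣|X| = trans (sym (odd-card X)) (¬2∣⇒odd _ ¬2∣|X|)
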